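{- For every even integer $n \ge 5$ (i.e. even $n\ge 6$), $\mathrm{eqdim}(S''_n)=2n$.
   Context: All graphs are finite, simple, connected and undirected; $d(u,v)$ denotes the number of edges of a shortest path between $u$ and $v$. A vertex $x$ is equidistant from $u$ and $v$ if $d(u,x)=d(v,x)$. A set $S\subseteq V(G)$ is a distance-equalizer set of $G$ if for every pair of distinct vertices $u,v\in V(G)\setminus S$ there is $x\in S$ equidistant from $u$ and $v$. The equidistant dimension $\mathrm{eqdim}(G)$ is the minimum cardinality of a distance-equalizer set of $G$. The graph $S''_n$ has vertex set $\{a_i,b_i,c_i,d_i : i=0,\dots,n-1\}$ and edge set $\{a_ia_{i+1}, b_ib_{i+1}, c_ic_{i+1}, d_id_{i+1}, a_ib_i, b_ic_i, c_id_i, b_{i+1}c_i : i=0,\dots,n-1\}$, with indices taken modulo $n$. -}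

module Defs where

open import Data.Nat using (ℕ; zero; suc; _≤_)
open import Data.Nat.DivMod using (_mod_)
open import Data.Fin using (Fin; toℕ)
open import Data.Product using (Σ; ∃; _×_; _,_)
open import Data.Sum using (_⊎_)
open import Data.List using (List; length)
open import Data.List.Membership.Propositional using (_∈_)
open import Data.List.Relation.Unary.Unique.Propositional using (Unique)
open import Relation.Binary.PropositionalEquality using (_≡_)
open import Relation.Nullary using (¬_)

data Walk {V : Set} (Adj : V → V → Set) : V → V → ℕ → Set where
  here : ∀ {u} → Walk Adj u u 0
  step : ∀ {u w v k} → Adj u w → Walk Adj w v k → Walk Adj u v (suc k)

Dist : {V : Set} (Adj : V → V → Set) → V → V → ℕ → Set
Dist Adj u v k = Walk Adj u v k × (∀ j → Walk Adj u v j → k ≤ j)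

Equidistant : {V : Set} (Adj : V → V → Set) → V → V → V → Set
Equidistant Adj x u v = ∃ λ k → Dist Adj u x k × Dist Adj v x k

IsDistanceEqualizer : {V : Set} (Adj : V → V → Set) → List V → Set
IsDistanceEqualizer {V} Adj S =
  ∀ (u v : V) → ¬ (u ≡ v) → ¬ (u ∈ S) → ¬ (v ∈ S) →
  ∃ λ x → x ∈ S × Equidistant Adj x u v

EqDimIs : {V : Set} (Adj : V → V → Set) → ℕ → Set
EqDimIs {V} Adj k =
  (Σ (List V) λ S → Unique S × IsDistanceEqualizer Adj S × length S ≡ k)
  × (∀ (S : List V) → Unique S → IsDistanceEqualizer Adj S → k ≤ length S)

data Layer : Set where
  a b c d : Layer

SV : ℕ → Set
SV n = Layer × Fin n

next : ∀ {n} → Fin n → Fin n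
next {suc m} i = suc (toℕ i) mod suc m

-- the edge list of S''_n (one orientation per edge)
data SEdge (n : ℕ) : SV n → SV n → Set where
  aa : ∀ i → SEdge n (a , i) (a , next i)
  bb : ∀ i → SEdge n (b , i) (b , next i)
  cc : ∀ i → SEdge n (c , i) (c , next i)
  dd : ∀ i → SEdge n (d , i) (d , next i)
  ab : ∀ i → SEdge n (a , i) (b , i)
  bc : ∀ i → SEdge n (b , i) (c , i)
  cd : ∀ i → SEdge n (c , i) (d , i)
  bc' : ∀ i → SEdge n (b , next i) (c , i)

SAdj : (n : ℕ) → SV n → SV n → Set
SAdj n u v = SEdge n u v ⊎ SEdge n v u

module Submission where

-- Put vertex (l , i) of S''ₙ at position 2i (layers a, b) or 2i + 1 (layers c, d) of a cycle of
-- length N = 2n. The band formed by the layers b and c is then the square of that cycle, and the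
-- layers a and d are copies of its even and odd positions hanging off it by the rungs a–b and c–d.
-- Hence d(u , x) = ⌈δ / 2⌉ + detour, where δ is the cyclic distance between the positions and
-- detour is the cost of climbing between the band and the outer layers; this is proved by showing
-- that the right-hand side vanishes only at x, drops by one along some edge and by at most one
-- along every edge.
--
-- The two ends of a rung have the same position and detours differing by one to every layer, so no
-- vertex is equidistant from them: a distance-equalizer meets each of the 2n rungs. Conversely the
-- layers a and c form one: they occupy every position, so two vertices of the same layer are
-- equalized at the midpoint of an arc joining them, and b_i, d_j at a point splitting an arc
-- between them into lengths 2w + 1 (towards b_i) and 2w. The two arcs between b_i and d_j have odd
-- lengths adding up to N, so when 4 divides N (this is where n must be even) one of them has
-- length ≡ 1 (mod 4) and splits in this way.

open import Data.Empty using (⊥-elim)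
open import Data.Fin using (Fin; toℕ; fromℕ<; splitAt; _↑ˡ_; _↑ʳ_)
open import Data.Fin.Properties
  using (toℕ-fromℕ<; toℕ-injective; toℕ<n; injective⇒≤; splitAt⁻¹-↑ˡ; splitAt⁻¹-↑ʳ)
  renaming (_≟_ to _≟ᶠ_)
open import Data.List using (List; length; map; _++_; allFin; lookup)
open import Data.List.Properties using (length-++; length-map; length-tabulate)
open import Data.List.Membership.Propositional using (_∈_)
import Data.List.Membership.DecPropositional as DecMembership
open import Data.List.Membership.Propositional.Properties using (∈-map⁺; ∈-map⁻; ∈-++⁺ˡ; ∈-++⁺ʳ; ∈-allFin)
open import Data.List.Relation.Unary.Any using (index)
open import Data.List.Relation.Unary.Any.Properties using (lookup-index)
open import Data.List.Relation.Unary.Unique.Propositional using (Unique)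
open import Data.List.Relation.Unary.Unique.Propositional.Properties using (map⁺; ++⁺; allFin⁺)
open import Data.Nat
open import Data.Nat.Divisibility using (_∣_; divides)
open import Data.Nat.DivMod
  using (_%_; _/_; _mod_; %-distribˡ-+; m%n%n≡m%n; [m+n]%n≡m%n; [m+kn]%n≡m%n; m<n⇒m%n≡m;
         m%n<n; m%n≤m; n%n≡0; m≡m%n+[m/n]*n)
open import Data.Nat.Properties
open import Data.Nat.Tactic.RingSolver using (solve-∀)
open import Data.Parity.Base as ℙ using (Parity; 0ℙ; 1ℙ)
import Data.Parity.Properties as ℙ
open import Data.Product using (∃; ∃₂; _×_; _,_; proj₁; proj₂; swap)
open import Data.Product.Properties using (≡-dec)
open import Data.Sum as Sum using (_⊎_; inj₁; inj₂; [_,_]′)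
open import Function using (_∘_; id)
open import Level using (0ℓ)
open import Relation.Binary.Bundles using (Setoid)
open import Relation.Binary.Definitions using (DecidableEquality)
open import Relation.Binary.PropositionalEquality
import Relation.Binary.Reasoning.Setoid as SetoidReasoning
open import Relation.Binary.Structures using (IsEquivalence)
open import Relation.Nullary using (¬_; yes; no)

open import Defs
open import Algebra.Properties.CommutativeSemigroup +-commutativeSemigroup
  using (xy∙z≈x∙zy; xy∙z≈xz∙y; xy∙z≈yx∙z)

data Halving : ℕ → Set where
  even : ∀ k → Halving (k + k)
  odd  : ∀ k → Halving (suc (k + k))

halving : ∀ r → Halving r
halving zero = even 0
halving (suc r) with halving r
... | even k = odd k
... | odd k  = subst Halving (cong suc (+-suc k k)) (even (suc k))

⌈n/2⌉≡0⇒n≡0 : ∀ {h} → ⌈ h /2⌉ ≡ 0 → h ≡ 0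
⌈n/2⌉≡0⇒n≡0 {zero}        _  = refl
⌈n/2⌉≡0⇒n≡0 {suc zero}    ()
⌈n/2⌉≡0⇒n≡0 {suc (suc h)} ()

parity-double : ∀ k → parity (k + k) ≡ 0ℙ
parity-double k = trans (ℙ.+-homo-+ k k) (ℙ.p+p≡0ℙ (parity k))

parity-odd : ∀ k → parity (suc (k + k)) ≡ 1ℙ
parity-odd k = trans (ℙ.+-homo-+ 1 (k + k)) (cong ℙ._⁻¹ (parity-double k))

x+y≡z⇒y≡x+z : ∀ {x y z} → x ℙ.+ y ≡ z → y ≡ x ℙ.+ z
x+y≡z⇒y≡x+z {0ℙ}     refl = refl
x+y≡z⇒y≡x+z {1ℙ} {y} refl = sym (ℙ.⁻¹-involutive y)

module Congruence (N : ℕ) .{{_ : NonZero N}} where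

  infix 4 _≋_
  record _≋_ (m n : ℕ) : Set where
    constructor mod-≡
    field %-≡ : m % N ≡ n % N
  open _≋_ public

  ≋-isEquivalence : IsEquivalence _≋_
  ≋-isEquivalence = record
    { refl  = mod-≡ refl
    ; sym   = λ m≋n → mod-≡ (sym (%-≡ m≋n))
    ; trans = λ m≋n n≋o → mod-≡ (trans (%-≡ m≋n) (%-≡ n≋o))
    }

  ≋-setoid : Setoid 0ℓ 0ℓ
  ≋-setoid = record { isEquivalence = ≋-isEquivalence }

  open IsEquivalence ≋-isEquivalence public
    using () renaming (sym to ≋-sym; trans to ≋-trans; reflexive to ≋-reflexive)

  module ≋-Reasoning = SetoidReasoning ≋-setoid

  %-≋ : ∀ m → m % N ≋ m
  %-≋ m = mod-≡ (m%n%n≡m%n m N)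

  +N-≋ : ∀ m → m + N ≋ m
  +N-≋ m = mod-≡ ([m+n]%n≡m%n m N)

  ≋-+ʳ : ∀ {m n} k → m ≋ n → m + k ≋ n + k
  ≋-+ʳ {m} {n} k (mod-≡ m%≡n%) = mod-≡ (begin
    (m + k) % N           ≡⟨ %-distribˡ-+ m k N ⟩
    (m % N + k % N) % N   ≡⟨ cong (λ r → (r + k % N) % N) m%≡n% ⟩
    (n % N + k % N) % N   ≡⟨ %-distribˡ-+ n k N ⟨
    (n + k) % N           ∎)
    where open ≡-Reasoning

  ≋-+ˡ : ∀ {m n} k → m ≋ n → k + m ≋ k + n
  ≋-+ˡ {m} {n} k m≋n = begin
    k + m  ≡⟨ +-comm k m ⟩
    m + k  ≈⟨ ≋-+ʳ k m≋n ⟩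
    n + k  ≡⟨ +-comm n k ⟩
    k + n  ∎
    where open ≋-Reasoning

  ≋-cancelʳ : ∀ {m n} k → m + k ≋ n + k → m ≋ n
  ≋-cancelʳ {m} {n} k m+k≋n+k = ≋-trans (≋-sym (undo m)) (≋-trans (≋-+ʳ (N ∸ k % N) m+k≋n+k) (undo n))
    where
    undo : ∀ x → x + k + (N ∸ k % N) ≋ x
    undo x = begin
      x + k + (N ∸ k % N)        ≈⟨ ≋-+ʳ (N ∸ k % N) (≋-+ˡ x (%-≋ k)) ⟨
      x + k % N + (N ∸ k % N)    ≡⟨ +-assoc x (k % N) _ ⟩
      x + (k % N + (N ∸ k % N))  ≡⟨ cong (x +_) (m+[n∸m]≡n (<⇒≤ (m%n<n k N))) ⟩
      x + N                      ≈⟨ +N-≋ x ⟩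
      x                          ∎
      where open ≋-Reasoning

  ≋-complement : ∀ {p h q L} → h + L ≡ N → p + h ≋ q → q + L ≋ p
  ≋-complement {p} {h} {q} {L} h+L≡N p+h≋q = begin
    q + L      ≈⟨ ≋-+ʳ L p+h≋q ⟨
    p + h + L  ≡⟨ trans (+-assoc p h L) (cong (p +_) h+L≡N) ⟩
    p + N      ≈⟨ +N-≋ p ⟩
    p          ∎
    where open ≋-Reasoning

  ≋⇒≡ : ∀ {m n} → m < N → n < N → m ≋ n → m ≡ n
  ≋⇒≡ m<N n<N (mod-≡ m%≡n%) = trans (sym (m<n⇒m%n≡m m<N)) (trans m%≡n% (m<n⇒m%n≡m n<N))

  ≋-parity : parity N ≡ 0ℙ → ∀ {m n} → m ≋ n → parity m ≡ parity n
  ≋-parity N-even {m} {n} (mod-≡ m%≡n%) = trans (sym (parity-% m)) (trans (cong parity m%≡n%) (parity-% n))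
    where
    parity-% : ∀ x → parity (x % N) ≡ parity x
    parity-% x = sym (begin
      parity x                               ≡⟨ cong parity (m≡m%n+[m/n]*n x N) ⟩
      parity (x % N + x / N * N)             ≡⟨ ℙ.+-homo-+ (x % N) _ ⟩
      parity (x % N) ℙ.+ parity (x / N * N)  ≡⟨ cong (parity (x % N) ℙ.+_) multiple-even ⟩
      parity (x % N) ℙ.+ 0ℙ                  ≡⟨ ℙ.+-identityʳ _ ⟩
      parity (x % N)                         ∎)
      where
      open ≡-Reasoning
      multiple-even : parity (x / N * N) ≡ 0ℙ
      multiple-even = trans (ℙ.*-homo-* (x / N) N) (trans (cong (parity (x / N) ℙ.*_) N-even) (ℙ.*-zeroʳ _))

module Cycle (N : ℕ) .{{_ : NonZero N}} where

  open Congruence N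

  Arc : ℕ → ℕ → ℕ → Set
  Arc p L q = p + L ≋ q ⊎ q + L ≋ p

  Arc-sym : ∀ {p L q} → Arc p L q → Arc q L p
  Arc-sym = [ inj₂ , inj₁ ]′

  Arc-complement : ∀ {p h q L} → h + L ≡ N → Arc p h q → Arc p L q
  Arc-complement h+L≡N (inj₁ p+h≋q) = inj₂ (≋-complement h+L≡N p+h≋q)
  Arc-complement h+L≡N (inj₂ q+h≋p) = inj₁ (≋-complement h+L≡N q+h≋p)

  ≋-concat : ∀ {p i q j r} → p + i ≋ q → q + j ≋ r → p + (i + j) ≋ r
  ≋-concat {p} {i} {q} {j} {r} p+i≋q q+j≋r = begin
    p + (i + j)  ≡⟨ +-assoc p i j ⟨
    p + i + j    ≈⟨ ≋-+ʳ j p+i≋q ⟩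
    q + j        ≈⟨ q+j≋r ⟩
    r            ∎
    where open ≋-Reasoning

  offset : ℕ → ℕ → ℕ
  offset p q = (q + (N ∸ p % N)) % N

  ‖_‖ : ℕ → ℕ
  ‖ r ‖ = r ⊓ (N ∸ r)

  cdist : ℕ → ℕ → ℕ
  cdist p q = ‖ offset p q ‖

  private
    undo-% : ∀ p x → p + x + (N ∸ p % N) ≋ x
    undo-% p x = begin
      p + x + (N ∸ p % N)        ≈⟨ ≋-+ʳ _ (≋-+ʳ x (%-≋ p)) ⟨
      p % N + x + (N ∸ p % N)    ≡⟨ xy∙z≈yx∙z (p % N) x _ ⟩
      x + p % N + (N ∸ p % N)    ≡⟨ +-assoc x (p % N) _ ⟩
      x + (p % N + (N ∸ p % N))  ≡⟨ cong (x +_) (m+[n∸m]≡n (<⇒≤ (m%n<n p N))) ⟩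
      x + N                      ≈⟨ +N-≋ x ⟩
      x                          ∎
      where open ≋-Reasoning

  offset-≋ : ∀ {p t q} → p + t ≋ q → offset p q ≡ t % N
  offset-≋ {p} {t} {q} p+t≋q = %-≡ (begin
    q + (N ∸ p % N)      ≈⟨ ≋-+ʳ _ p+t≋q ⟨
    p + t + (N ∸ p % N)  ≈⟨ undo-% p t ⟩
    t                    ∎)
    where open ≋-Reasoning

  +offset-≋ : ∀ p q → p + offset p q ≋ q
  +offset-≋ p q = begin
    p + offset p q         ≈⟨ ≋-+ˡ p (%-≋ _) ⟩
    p + (q + (N ∸ p % N))  ≡⟨ +-assoc p q _ ⟨
    p + q + (N ∸ p % N)    ≈⟨ undo-% p q ⟩
    q                      ∎
    where open ≋-Reasoning

  ‖‖-short : ∀ {r} → r + r ≤ N → ‖ r ‖ ≡ r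
  ‖‖-short {r} r+r≤N = m≤n⇒m⊓n≡m (m+n≤o⇒m≤o∸n r r+r≤N)

  ‖‖-flip : ∀ {r} → r ≤ N → ‖ N ∸ r ‖ ≡ ‖ r ‖
  ‖‖-flip {r} r≤N = trans (cong ((N ∸ r) ⊓_) (m∸[m∸n]≡n r≤N)) (⊓-comm (N ∸ r) r)

  short⇒<N : ∀ {h} → h + h ≤ N → h < N
  short⇒<N {zero}  _     = >-nonZero⁻¹ N
  short⇒<N {suc h} h+h≤N = <-≤-trans (m<m+n (suc h) z<s) h+h≤N

  cdist-arc : ∀ p q → cdist p q + cdist p q ≤ N × Arc p (cdist p q) q
  cdist-arc p q = short , direction (⊓-sel r (N ∸ r))
    where
    r : ℕ
    r = offset p q
    r≤N : r ≤ N
    r≤N = <⇒≤ (m%n<n _ N)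
    short : ‖ r ‖ + ‖ r ‖ ≤ N
    short = ≤-trans (+-mono-≤ (m⊓n≤m r (N ∸ r)) (m⊓n≤n r (N ∸ r))) (≤-reflexive (m+[n∸m]≡n r≤N))
    direction : ‖ r ‖ ≡ r ⊎ ‖ r ‖ ≡ N ∸ r → Arc p ‖ r ‖ q
    direction (inj₁ ‖r‖≡r)   = inj₁ (subst (λ h → p + h ≋ q) (sym ‖r‖≡r) (+offset-≋ p q))
    direction (inj₂ ‖r‖≡N∸r) =
      inj₂ (subst (λ h → q + h ≋ p) (sym ‖r‖≡N∸r) (≋-complement (m+[n∸m]≡n r≤N) (+offset-≋ p q)))

  short-arc⇒cdist≡ : ∀ {p q h} → h + h ≤ N → Arc p h q → cdist p q ≡ h
  short-arc⇒cdist≡ {p} {q} {h} h+h≤N (inj₁ p+h≋q) = begin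
    ‖ offset p q ‖  ≡⟨ cong ‖_‖ (offset-≋ p+h≋q) ⟩
    ‖ h % N ‖       ≡⟨ cong ‖_‖ (m<n⇒m%n≡m (short⇒<N h+h≤N)) ⟩
    ‖ h ‖           ≡⟨ ‖‖-short h+h≤N ⟩
    h               ∎
    where open ≡-Reasoning
  short-arc⇒cdist≡ {p} {q} {h} h+h≤N (inj₂ q+h≋p) =
    trans (cong ‖_‖ (offset-≋ (≋-complement (m+[n∸m]≡n (<⇒≤ (short⇒<N {h} h+h≤N))) q+h≋p))) (flip h h+h≤N)
    where
    flip : ∀ h → h + h ≤ N → ‖ (N ∸ h) % N ‖ ≡ h
    flip zero    _     = cong ‖_‖ (n%n≡0 N)
    flip (suc h) h+h≤N = begin
      ‖ (N ∸ suc h) % N ‖  ≡⟨ cong ‖_‖ (m<n⇒m%n≡m (∸-monoʳ-< z<s (<⇒≤ (short⇒<N h+h≤N)))) ⟩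
      ‖ N ∸ suc h ‖        ≡⟨ ‖‖-flip (<⇒≤ (short⇒<N h+h≤N)) ⟩
      ‖ suc h ‖            ≡⟨ ‖‖-short h+h≤N ⟩
      suc h                ∎
      where open ≡-Reasoning

  cdist-comm : ∀ p q → cdist p q ≡ cdist q p
  cdist-comm p q = short-arc⇒cdist≡ (proj₁ (cdist-arc q p)) (Arc-sym (proj₂ (cdist-arc q p)))

  cdist-self : ∀ p → cdist p p ≡ 0
  cdist-self p = short-arc⇒cdist≡ z≤n (inj₁ (≋-reflexive (+-identityʳ p)))

  cdist≡0⇒≋ : ∀ {p q} → cdist p q ≡ 0 → p ≋ q
  cdist≡0⇒≋ {p} {q} h≡0 with proj₂ (cdist-arc p q)
  ... | inj₁ p+h≋q = ≋-trans (≋-reflexive (sym (trans (cong (p +_) h≡0) (+-identityʳ p)))) p+h≋q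
  ... | inj₂ q+h≋p = ≋-sym (≋-trans (≋-reflexive (sym (trans (cong (q +_) h≡0) (+-identityʳ q)))) q+h≋p)

  arc⇒cdist≤ : ∀ {p q t} → Arc p t q → cdist p q ≤ t
  arc⇒cdist≤ (inj₁ p+t≋q) = forward p+t≋q
    where
    forward : ∀ {p q t} → p + t ≋ q → cdist p q ≤ t
    forward {p} {q} {t} p+t≋q = begin
      ‖ offset p q ‖  ≤⟨ m⊓n≤m _ _ ⟩
      offset p q      ≡⟨ offset-≋ p+t≋q ⟩
      t % N           ≤⟨ m%n≤m t N ⟩
      t               ∎
      where open ≤-Reasoning
  arc⇒cdist≤ {p} {q} (inj₂ q+t≋p) = subst (_≤ _) (cdist-comm q p) (arc⇒cdist≤ (inj₁ q+t≋p))

  cdist-meet : ∀ {x y i j} → x + i ≋ y + j → cdist x y ≤ i + j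
  cdist-meet {x} {y} {i} {j} x+i≋y+j with ≤-total i j
  ... | inj₁ i≤j with m≤n⇒∃[o]m+o≡n i≤j
  ...   | e , refl = ≤-trans (arc⇒cdist≤ (inj₂ y+e≋x)) (≤-trans (m≤n+m e i) (m≤n+m (i + e) i))
    where
    y+e≋x : y + e ≋ x
    y+e≋x = ≋-cancelʳ i (≋-trans (≋-reflexive (xy∙z≈x∙zy y e i)) (≋-sym x+i≋y+j))
  cdist-meet {x} {y} {i} {j} x+i≋y+j | inj₂ j≤i with m≤n⇒∃[o]m+o≡n j≤i
  ...   | e , refl = ≤-trans (arc⇒cdist≤ (inj₁ x+e≋y)) (≤-trans (m≤n+m e j) (m≤m+n (j + e) j))
    where
    x+e≋y : x + e ≋ y
    x+e≋y = ≋-cancelʳ j (≋-trans (≋-reflexive (xy∙z≈x∙zy x e j)) x+i≋y+j)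

  cdist-triangle : ∀ p q r → cdist p r ≤ cdist p q + cdist q r
  cdist-triangle p q r = via-arcs (proj₂ (cdist-arc p q)) (proj₂ (cdist-arc q r))
    where
    via-arcs : ∀ {i j} → Arc p i q → Arc q j r → cdist p r ≤ i + j
    via-arcs {i} {j} (inj₁ p+i≋q) (inj₁ q+j≋r) = arc⇒cdist≤ (inj₁ (≋-concat {p} {i} {q} {j} p+i≋q q+j≋r))
    via-arcs {i} {j} (inj₂ q+i≋p) (inj₂ r+j≋q) =
      subst (cdist p r ≤_) (+-comm j i) (arc⇒cdist≤ (inj₂ (≋-concat {r} {j} {q} {i} r+j≋q q+i≋p)))
    via-arcs {i} {j} (inj₁ p+i≋q) (inj₂ r+j≋q) = cdist-meet {p} {r} {i} {j} (≋-trans p+i≋q (≋-sym r+j≋q))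
    via-arcs {i} {j} (inj₂ q+i≋p) (inj₁ q+j≋r) =
      subst (cdist p r ≤_) (+-comm j i) (cdist-meet {p} {r} {j} {i} p+j≋r+i)
      where
      p+j≋r+i : p + j ≋ r + i
      p+j≋r+i = begin
        p + j      ≈⟨ ≋-+ʳ j q+i≋p ⟨
        q + i + j  ≡⟨ xy∙z≈xz∙y q i j ⟩
        q + j + i  ≈⟨ ≋-+ʳ i q+j≋r ⟩
        r + i      ∎
        where open ≋-Reasoning

  cdist-lipschitz : ∀ {p p' s} q → p + s ≋ p' → cdist p q ≤ s + cdist p' q × cdist p' q ≤ s + cdist p q
  cdist-lipschitz {p} {p'} q p+s≋p' =
      ≤-trans (cdist-triangle p p' q) (+-monoˡ-≤ (cdist p' q) (arc⇒cdist≤ (inj₁ p+s≋p')))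
    , ≤-trans (cdist-triangle p' p q) (+-monoˡ-≤ (cdist p q) (arc⇒cdist≤ (inj₂ p+s≋p')))

  cdist-descent : ∀ {p q s k} → cdist p q ≡ s + k →
                  (∀ {p'} → p + s ≋ p' → cdist p' q ≡ k) ⊎ (∀ {p'} → p' + s ≋ p → cdist p' q ≡ k)
  cdist-descent {p} {q} {s} {k} pq≡s+k with short , arc ← subst (λ h → h + h ≤ N × Arc p h q) pq≡s+k (cdist-arc p q)
    = Sum.map (ahead (k+k≤N short)) (behind (k+k≤N short)) arc
    where
    k+k≤N : (s + k) + (s + k) ≤ N → k + k ≤ N
    k+k≤N short = ≤-trans (+-mono-≤ (m≤n+m k s) (m≤n+m k s)) short
    ahead : k + k ≤ N → p + (s + k) ≋ q → ∀ {p'} → p + s ≋ p' → cdist p' q ≡ k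
    ahead k+k≤N p+s+k≋q {p'} p+s≋p' = short-arc⇒cdist≡ k+k≤N (inj₁ (begin
      p' + k       ≈⟨ ≋-+ʳ k p+s≋p' ⟨
      p + s + k    ≡⟨ +-assoc p s k ⟩
      p + (s + k)  ≈⟨ p+s+k≋q ⟩
      q            ∎))
      where open ≋-Reasoning
    behind : k + k ≤ N → q + (s + k) ≋ p → ∀ {p'} → p' + s ≋ p → cdist p' q ≡ k
    behind k+k≤N q+s+k≋p {p'} p'+s≋p = short-arc⇒cdist≡ k+k≤N (inj₂ (≋-cancelʳ s (begin
      q + k + s    ≡⟨ xy∙z≈x∙zy q k s ⟩
      q + (s + k)  ≈⟨ q+s+k≋p ⟩
      p            ≈⟨ p'+s≋p ⟨
      p' + s       ∎)))
      where open ≋-Reasoning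

  cdist-parity : parity N ≡ 0ℙ → ∀ p q → parity (cdist p q) ≡ parity p ℙ.+ parity q
  cdist-parity N-even p q with proj₂ (cdist-arc p q)
  ... | inj₁ p+h≋q = x+y≡z⇒y≡x+z {parity p} (trans (sym (ℙ.+-homo-+ p (cdist p q))) (≋-parity N-even p+h≋q))
  ... | inj₂ q+h≋p =
    trans (x+y≡z⇒y≡x+z {parity q} (trans (sym (ℙ.+-homo-+ q (cdist p q))) (≋-parity N-even q+h≋p)))
          (ℙ.+-comm (parity q) (parity p))

  arc-point : ∀ {p q s t} → s + s ≤ N → t + t ≤ N → Arc p (s + t) q →
              ∃ λ X → X < N × cdist p X ≡ s × cdist q X ≡ t
  arc-point {p} {q} {s} {t} s+s≤N t+t≤N (inj₁ p+s+t≋q) =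
    (p + s) % N , m%n<n _ N , short-arc⇒cdist≡ s+s≤N (inj₁ (≋-sym (%-≋ (p + s)))) , short-arc⇒cdist≡ t+t≤N (inj₂ X+t≋q)
    where
    X+t≋q : (p + s) % N + t ≋ q
    X+t≋q = ≋-trans (≋-+ʳ t (%-≋ (p + s))) (≋-trans (≋-reflexive (+-assoc p s t)) p+s+t≋q)
  arc-point {p} {q} {s} {t} s+s≤N t+t≤N (inj₂ q+s+t≋p)
    with X , X<N , qX≡t , pX≡s ← arc-point t+t≤N s+s≤N (inj₁ (subst (λ L → q + L ≋ p) (+-comm s t) q+s+t≋p))
    = X , X<N , pX≡s , qX≡t

  even-arc-midpoint : ∀ P Q → parity (cdist P Q) ≡ 0ℙ → ∃ λ X → X < N × cdist P X ≡ cdist Q X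
  even-arc-midpoint P Q = bisect (halving (cdist P Q)) (cdist-arc P Q)
    where
    bisect : ∀ {h} → Halving h → h + h ≤ N × Arc P h Q → parity h ≡ 0ℙ →
               ∃ λ X → X < N × cdist P X ≡ cdist Q X
    bisect (odd k)  _             h-even = ⊥-elim (ℙ.p≢p⁻¹ 1ℙ (trans (sym (parity-odd k)) h-even))
    bisect (even e) (short , arc) _      =
      let X , X<N , PX≡e , QX≡e = arc-point {s = e} {e} e+e≤N e+e≤N arc in X , X<N , trans PX≡e (sym QX≡e)
      where
      e+e≤N : e + e ≤ N
      e+e≤N = ≤-trans (m≤m+n (e + e) (e + e)) short

  -- The short arc from P to Q has length 2m + 1; when m is odd, the long arc, of length ≡ 1 (mod 4),
  -- is split instead.
  odd-arc-split : ∀ {q} → N ≡ q * 4 → ∀ P Q → parity (cdist P Q) ≡ 1ℙ →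
              ∃₂ λ X w → X < N × cdist P X ≡ suc (w + w) × cdist Q X ≡ w + w
  odd-arc-split {q} N≡4q P Q = split (halving (cdist P Q)) (cdist-arc P Q)
    where
    Goal : Set
    Goal = ∃₂ λ X w → X < N × cdist P X ≡ suc (w + w) × cdist Q X ≡ w + w

    split-arc : ∀ w → suc (w + w) + suc (w + w) ≤ N → w + w + (w + w) ≤ N →
                Arc P (suc (w + w) + (w + w)) Q → Goal
    split-arc w s+s≤N t+t≤N arc = let X , X<N , PX , QX = arc-point s+s≤N t+t≤N arc in X , w , X<N , PX , QX

    split-half : ∀ {m} → Halving m → suc (m + m) + suc (m + m) ≤ N → Arc P (suc (m + m)) Q → Goal
    split-half (even w) short arc =
      split-arc w (≤-trans (+-mono-≤ s≤ℓ s≤ℓ) short) (≤-trans (+-mono-≤ t≤ℓ t≤ℓ) short) arc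
      where
      s≤ℓ : suc (w + w) ≤ suc (w + w + (w + w))
      s≤ℓ = s≤s (m≤m+n (w + w) (w + w))
      t≤ℓ : w + w ≤ suc (w + w + (w + w))
      t≤ℓ = ≤-trans (m≤m+n (w + w) (w + w)) (n≤1+n _)
    split-half (odd w) short arc = long-arc (m≤n⇒∃[o]m+o≡n w<q)
      where
      ℓ : ℕ
      ℓ = suc (suc (w + w) + suc (w + w))
      w<q : w < q
      w<q = *-cancelʳ-< 4 w q (begin-strict
        w * 4      <⟨ m<n+m (w * 4) z<s ⟩
        3 + w * 4  ≡⟨ ℓ≡3+4w w ⟨
        ℓ          ≤⟨ ≤-trans (m≤m+n ℓ ℓ) short ⟩
        N          ≡⟨ N≡4q ⟩
        q * 4      ∎)
        where
        open ≤-Reasoning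
        ℓ≡3+4w : ∀ w → suc (suc (w + w) + suc (w + w)) ≡ 3 + w * 4
        ℓ≡3+4w = solve-∀
      long-arc : (∃ λ v → suc w + v ≡ q) → Goal
      long-arc (v , 1+w+v≡q) = split-arc v s+s≤N t+t≤N (Arc-complement ℓ+L≡N arc)
        where
        L : ℕ
        L = suc (v + v) + (v + v)
        ℓ+L≡N : ℓ + L ≡ N
        ℓ+L≡N = trans (ℓ+L≡[1+w+v]*4 w v) (trans (cong (_* 4) 1+w+v≡q) (sym N≡4q))
          where
          ℓ+L≡[1+w+v]*4 : ∀ w v → suc (suc (w + w) + suc (w + w)) + (suc (v + v) + (v + v)) ≡ (suc w + v) * 4
          ℓ+L≡[1+w+v]*4 = solve-∀
        s+s≤N : suc (v + v) + suc (v + v) ≤ N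
        s+s≤N = begin
          suc (v + v) + suc (v + v)  ≡⟨ cong suc (+-suc (v + v) (v + v)) ⟩
          suc L                      ≤⟨ s≤s (m≤n+m L (suc (w + w) + suc (w + w))) ⟩
          ℓ + L                      ≡⟨ ℓ+L≡N ⟩
          N                          ∎
          where open ≤-Reasoning
        t+t≤N : v + v + (v + v) ≤ N
        t+t≤N = ≤-trans (≤-trans (n≤1+n _) (m≤n+m L ℓ)) (≤-reflexive ℓ+L≡N)

    split : ∀ {h} → Halving h → h + h ≤ N × Arc P h Q → parity h ≡ 1ℙ → Goal
    split (even e) _             h-odd = ⊥-elim (ℙ.p≢p⁻¹ 0ℙ (trans (sym (parity-double e)) h-odd))
    split (odd m)  (short , arc) _     = split-half (halving m) short arc

module _ {V : Set} (Adj : V → V → Set) where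

  Dist-functional : ∀ {u v k k'} → Dist Adj u v k → Dist Adj u v k' → k ≡ k'
  Dist-functional (walk , shortest) (walk' , shortest') = ≤-antisym (shortest _ walk') (shortest' _ walk)

  record IsDistanceTo (x : V) (φ : V → ℕ) : Set where
    field
      φ-target    : φ x ≡ 0
      φ≡0⇒target  : ∀ {u} → φ u ≡ 0 → u ≡ x
      φ-descent   : ∀ {u k} → φ u ≡ suc k → ∃ λ w → Adj u w × φ w ≡ k
      φ-lipschitz : ∀ {u w} → Adj u w → φ u ≤ suc (φ w)

  IsDistanceTo⇒Dist : ∀ {x φ} → IsDistanceTo x φ → ∀ u → Dist Adj u x (φ u)
  IsDistanceTo⇒Dist {x} {φ} isDist u = walk-down _ refl , shortest
    where
    open IsDistanceTo isDist
    walk-down : ∀ k {u} → φ u ≡ k → Walk Adj u x k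
    walk-down zero    φu≡0   = subst (λ v → Walk Adj v x 0) (sym (φ≡0⇒target φu≡0)) here
    walk-down (suc k) φu≡1+k = let w , u~w , φw≡k = φ-descent φu≡1+k in step u~w (walk-down k φw≡k)
    φ≤length+φ : ∀ {u v k} → Walk Adj u v k → φ u ≤ k + φ v
    φ≤length+φ here            = ≤-refl
    φ≤length+φ (step u~w walk) = ≤-trans (φ-lipschitz u~w) (s≤s (φ≤length+φ walk))
    shortest : ∀ j → Walk Adj u x j → φ u ≤ j
    shortest j walk = subst (φ u ≤_) (trans (cong (j +_) φ-target) (+-identityʳ j)) (φ≤length+φ walk)

  module _ {dist : V → V → ℕ} (isDist : ∀ x → IsDistanceTo x (λ u → dist u x)) where

    equidistant⇒≡ : ∀ {x u v} → Equidistant Adj x u v → dist u x ≡ dist v x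
    equidistant⇒≡ {x} {u} {v} (_ , u-x , v-x) =
      trans (Dist-functional (IsDistanceTo⇒Dist (isDist x) u) u-x) (Dist-functional v-x (IsDistanceTo⇒Dist (isDist x) v))

    ≡⇒equidistant : ∀ {x u v} → dist u x ≡ dist v x → Equidistant Adj x u v
    ≡⇒equidistant {x} {u} {v} u-x≡v-x =
      dist u x , IsDistanceTo⇒Dist (isDist x) u , subst (Dist Adj v x) (sym u-x≡v-x) (IsDistanceTo⇒Dist (isDist x) v)

  equalizer-meets-pair : DecidableEquality V → ∀ {S u v} → IsDistanceEqualizer Adj S → u ≢ v →
                         (∀ x → ¬ Equidistant Adj x u v) → u ∈ S ⊎ v ∈ S
  equalizer-meets-pair _≟_ {S} {u} {v} isDE u≢v unequal with u ∈? S | v ∈? S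
    where open DecMembership _≟_ using (_∈?_)
  ... | yes u∈S | _       = inj₁ u∈S
  ... | no _    | yes v∈S = inj₂ v∈S
  ... | no u∉S  | no v∉S  = let x , _ , x-equalizes = isDE u v u≢v u∉S v∉S in ⊥-elim (unequal x x-equalizes)

onto-Fin⇒≤length : ∀ {A : Set} {k} (S : List A) (ι : A → Fin k) →
                   (∀ i → ∃ λ v → v ∈ S × ι v ≡ i) → k ≤ length S
onto-Fin⇒≤length S ι onto = injective⇒≤ pick-injective
  where
  pick : Fin _ → Fin (length S)
  pick i = index (proj₁ (proj₂ (onto i)))
  ι∘pick : ∀ i → ι (lookup S (pick i)) ≡ i
  ι∘pick i = trans (cong ι (sym (lookup-index (proj₁ (proj₂ (onto i)))))) (proj₂ (proj₂ (onto i)))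
  pick-injective : ∀ {i j} → pick i ≡ pick j → i ≡ j
  pick-injective {i} {j} pi≡pj = trans (sym (ι∘pick i)) (trans (cong (ι ∘ lookup S) pi≡pj) (ι∘pick j))

module S'' (m : ℕ) where

  n : ℕ
  n = suc m

  N : ℕ
  N = n + n

  open Congruence N
  open Cycle N
  private module Congruenceₙ = Congruence n

  side : Layer → ℕ
  side a = 0
  side b = 0
  side c = 1
  side d = 1

  height : Layer → ℕ
  height a = 1
  height b = 0
  height c = 0
  height d = 1

  detour : Layer → Layer → ℕ
  detour a a = 0
  detour d d = 0
  detour l l' = height l + height l'

  layer : SV n → Layer
  layer = proj₁

  pos : SV n → ℕ
  pos (l , i) = side l + (toℕ i + toℕ i)

  dist : SV n → SV n → ℕ
  dist u x = ⌈ cdist (pos u) (pos x) /2⌉ + detour (layer u) (layer x)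

  detour-self : ∀ l → detour l l ≡ 0
  detour-self a = refl
  detour-self b = refl
  detour-self c = refl
  detour-self d = refl

  detour-bc : ∀ l → detour b l ≡ detour c l
  detour-bc a = refl
  detour-bc b = refl
  detour-bc c = refl
  detour-bc d = refl

  rung-ab : ∀ l → ∣ detour a l - detour b l ∣ ≡ 1
  rung-ab a = refl
  rung-ab b = refl
  rung-ab c = refl
  rung-ab d = refl

  rung-cd : ∀ l → ∣ detour c l - detour d l ∣ ≡ 1
  rung-cd a = refl
  rung-cd b = refl
  rung-cd c = refl
  rung-cd d = refl

  same-layer : ∀ l l' → parity (side l) ≡ parity (side l') → detour l l' ≡ 0 → l ≡ l'
  same-layer a a _  _  = refl
  same-layer b b _  _  = refl
  same-layer c c _  _  = refl
  same-layer d d _  _  = refl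
  same-layer a b _  ()
  same-layer b a _  ()
  same-layer c d _  ()
  same-layer d c _  ()
  same-layer a c () _
  same-layer a d () _
  same-layer b c () _
  same-layer b d () _
  same-layer c a () _
  same-layer c b () _
  same-layer d a () _
  same-layer d b () _

  pos<N : ∀ u → pos u < N
  pos<N (l , i) = begin-strict
    side l + (toℕ i + toℕ i)  ≤⟨ +-mono-≤ (side≤1 l) (+-mono-≤ i≤m i≤m) ⟩
    1 + (m + m)               <⟨ s≤s (+-monoʳ-< m (n<1+n m)) ⟩
    N                         ∎
    where
    open ≤-Reasoning
    i≤m : toℕ i ≤ m
    i≤m = ≤-pred (toℕ<n i)
    side≤1 : ∀ l → side l ≤ 1
    side≤1 a = z≤n
    side≤1 b = z≤n
    side≤1 c = ≤-refl
    side≤1 d = ≤-refl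

  parity-pos : ∀ u → parity (pos u) ≡ parity (side (layer u))
  parity-pos (l , i) = begin
    parity (side l + (toℕ i + toℕ i))           ≡⟨ ℙ.+-homo-+ (side l) _ ⟩
    parity (side l) ℙ.+ parity (toℕ i + toℕ i)  ≡⟨ cong (parity (side l) ℙ.+_) (parity-double (toℕ i)) ⟩
    parity (side l) ℙ.+ 0ℙ                      ≡⟨ ℙ.+-identityʳ _ ⟩
    parity (side l)                             ∎
    where open ≡-Reasoning

  side-parity : SV n → SV n → Parity
  side-parity u x = parity (side (layer u)) ℙ.+ parity (side (layer x))

  cdist-pos-parity : ∀ u x → parity (cdist (pos u) (pos x)) ≡ side-parity u x
  cdist-pos-parity u x =
    trans (cdist-parity (parity-double n) (pos u) (pos x)) (cong₂ ℙ._+_ (parity-pos u) (parity-pos x))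

  same-place : ∀ {u x} → pos u ≡ pos x → detour (layer u) (layer x) ≡ 0 → u ≡ x
  same-place {l , i} {l' , j} same-pos detour≡0 = cong₂ _,_ l≡l' (toℕ-injective (double-injective
    (+-cancelˡ-≡ (side l) _ _ (trans same-pos (cong (λ l → side l + (toℕ j + toℕ j)) (sym l≡l'))))))
    where
    l≡l' : l ≡ l'
    l≡l' = same-layer l l' (trans (sym (parity-pos (l , i))) (trans (cong parity same-pos) (parity-pos (l' , j)))) detour≡0
    double-injective : ∀ {x y} → x + x ≡ y + y → x ≡ y
    double-injective {x} {y} x+x≡y+y = trans (n≡⌊n+n/2⌋ x) (trans (cong ⌊_/2⌋ x+x≡y+y) (sym (n≡⌊n+n/2⌋ y)))

  double-% : ∀ k → k % n + k % n ≋ k + k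
  double-% k = mod-≡ (sym (begin
    (k + k) % N                                    ≡⟨ cong (λ x → (x + x) % N) (m≡m%n+[m/n]*n k n) ⟩
    (k % n + k / n * n + (k % n + k / n * n)) % N  ≡⟨ cong (_% N) (regroup (k % n) (k / n) n) ⟩
    (k % n + k % n + k / n * N) % N                ≡⟨ [m+kn]%n≡m%n (k % n + k % n) (k / n) N ⟩
    (k % n + k % n) % N                            ∎))
    where
    open ≡-Reasoning
    regroup : ∀ r q n → r + q * n + (r + q * n) ≡ r + r + q * (n + n)
    regroup = solve-∀

  toℕ-next : ∀ i → toℕ (next i) ≡ suc (toℕ i) % n
  toℕ-next i = toℕ-fromℕ< (m%n<n (suc (toℕ i)) n)

  pos-next : ∀ l i → pos (l , next i) ≋ side l + (suc (toℕ i) + suc (toℕ i))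
  pos-next l i = begin
    side l + (toℕ (next i) + toℕ (next i))        ≡⟨ cong (λ t → side l + (t + t)) (toℕ-next i) ⟩
    side l + (suc (toℕ i) % n + suc (toℕ i) % n)  ≈⟨ ≋-+ˡ (side l) (double-% (suc (toℕ i))) ⟩
    side l + (suc (toℕ i) + suc (toℕ i))          ∎
    where open ≋-Reasoning

  next-surjective : ∀ i → ∃ λ j → next j ≡ i
  next-surjective i = j , toℕ-injective (begin
    toℕ (next j)               ≡⟨ toℕ-next j ⟩
    suc (toℕ j) % n            ≡⟨ cong (λ t → suc t % n) (toℕ-fromℕ< (m%n<n (toℕ i + m) n)) ⟩
    suc ((toℕ i + m) % n) % n  ≡⟨ Congruenceₙ.%-≡ (Congruenceₙ.≋-+ˡ 1 (Congruenceₙ.%-≋ (toℕ i + m))) ⟩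
    suc (toℕ i + m) % n        ≡⟨ cong (_% n) (+-suc (toℕ i) m) ⟨
    (toℕ i + n) % n            ≡⟨ [m+n]%n≡m%n (toℕ i) n ⟩
    toℕ i % n                  ≡⟨ m<n⇒m%n≡m (toℕ<n i) ⟩
    toℕ i                      ∎)
    where
    open ≡-Reasoning
    j : Fin n
    j = (toℕ i + m) mod n

  layer-step : ∀ l i → pos (l , i) + 2 ≋ pos (l , next i)
  layer-step l i = ≋-trans (≋-reflexive (two-more (side l) (toℕ i))) (≋-sym (pos-next l i))
    where
    two-more : ∀ s x → s + (x + x) + 2 ≡ s + (suc x + suc x)
    two-more = solve-∀

  b→c : ∀ i → pos (b , i) + 1 ≋ pos (c , i)
  b→c i = ≋-reflexive (+-comm (toℕ i + toℕ i) 1)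

  c→b : ∀ i → pos (c , i) + 1 ≋ pos (b , next i)
  c→b i = ≋-trans (≋-reflexive (one-more (toℕ i))) (≋-sym (pos-next b i))
    where
    one-more : ∀ x → suc (x + x) + 1 ≡ suc x + suc x
    one-more = solve-∀

  layer-edge : ∀ l i → SEdge n (l , i) (l , next i)
  layer-edge a = aa
  layer-edge b = bb
  layer-edge c = cc
  layer-edge d = dd

  record Neighbours (s : ℕ) (u : SV n) : Set where
    field
      ahead behind  : SV n
      to-ahead      : SAdj n u ahead
      to-behind     : SAdj n u behind
      ahead-shift   : pos u + s ≋ pos ahead
      behind-shift  : pos behind + s ≋ pos u
      ahead-detour  : ∀ l → detour (layer ahead) l ≡ detour (layer u) l
      behind-detour : ∀ l → detour (layer behind) l ≡ detour (layer u) l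

  layer-neighbours : ∀ u → Neighbours 2 u
  layer-neighbours (l , i) with j , refl ← next-surjective i = record
    { ahead        = l , next (next j)               ; behind        = l , j
    ; to-ahead     = inj₁ (layer-edge l (next j))   ; to-behind     = inj₂ (layer-edge l j)
    ; ahead-shift  = layer-step l (next j)          ; behind-shift  = layer-step l j
    ; ahead-detour = λ _ → refl                     ; behind-detour = λ _ → refl
    }

  band-neighbours-b : ∀ i → Neighbours 1 (b , i)
  band-neighbours-b i with j , refl ← next-surjective i = record
    { ahead        = c , next j          ; behind        = c , j
    ; to-ahead     = inj₁ (bc (next j))  ; to-behind     = inj₁ (bc' j)
    ; ahead-shift  = b→c (next j)        ; behind-shift  = c→b j
    ; ahead-detour = sym ∘ detour-bc     ; behind-detour = sym ∘ detour-bc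
    }

  band-neighbours-c : ∀ i → Neighbours 1 (c , i)
  band-neighbours-c i = record
    { ahead        = b , next i    ; behind        = b , i
    ; to-ahead     = inj₂ (bc' i)  ; to-behind     = inj₂ (bc i)
    ; ahead-shift  = c→b i         ; behind-shift  = b→c i
    ; ahead-detour = detour-bc     ; behind-detour = detour-bc
    }

  descend-to-neighbour : ∀ {s H k u} x → Neighbours s u → cdist (pos u) (pos x) ≡ s + H →
                         ⌈ s + H /2⌉ ≡ suc ⌈ H /2⌉ → dist u x ≡ suc k → ∃ λ w → SAdj n u w × dist w x ≡ k
  descend-to-neighbour {s} {H} {k} {u} x nb u-x≡s+H ⌈s+H/2⌉≡1+⌈H/2⌉ u-x≡1+k =
    [ (λ ahead-x  → ahead  , to-ahead  , arrive ahead  (ahead-x ahead-shift)   (ahead-detour (layer x)))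
    , (λ behind-x → behind , to-behind , arrive behind (behind-x behind-shift) (behind-detour (layer x)))
    ]′ (cdist-descent {pos u} {pos x} u-x≡s+H)
    where
    open Neighbours nb
    arrive : ∀ w → cdist (pos w) (pos x) ≡ H → detour (layer w) (layer x) ≡ detour (layer u) (layer x) →
             dist w x ≡ k
    arrive w w-x≡H same-detour = suc-injective (begin
      suc (dist w x)                            ≡⟨ cong₂ (λ h t → suc (⌈ h /2⌉ + t)) w-x≡H same-detour ⟩
      suc ⌈ H /2⌉ + detour (layer u) (layer x)  ≡⟨ cong (_+ detour (layer u) (layer x)) ⌈s+H/2⌉≡1+⌈H/2⌉ ⟨
      ⌈ s + H /2⌉ + detour (layer u) (layer x)  ≡⟨ cong (λ h → ⌈ h /2⌉ + detour (layer u) (layer x)) u-x≡s+H ⟨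
      dist u x                                  ≡⟨ u-x≡1+k ⟩
      suc k                                     ∎)
      where open ≡-Reasoning

  descend-horizontally : ∀ u x {k} → dist u x ≡ suc k → cdist (pos u) (pos x) ≢ 0 →
                         (cdist (pos u) (pos x) ≡ 1 → Neighbours 1 u) → ∃ λ w → SAdj n u w × dist w x ≡ k
  descend-horizontally u x {k} u-x≡1+k H≢0 band = by-length (cdist (pos u) (pos x)) refl
    where
    by-length : ∀ H → cdist (pos u) (pos x) ≡ H → ∃ λ w → SAdj n u w × dist w x ≡ k
    by-length 0             H≡0 = ⊥-elim (H≢0 H≡0)
    by-length 1             H≡1 = descend-to-neighbour x (band H≡1) H≡1 refl u-x≡1+k
    by-length (suc (suc H)) H≡  = descend-to-neighbour x (layer-neighbours u) H≡ refl u-x≡1+k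

  descend-rung : ∀ {u w k} x → SAdj n u w → pos u ≡ pos w →
                 detour (layer u) (layer x) ≡ suc (detour (layer w) (layer x)) →
                 dist u x ≡ suc k → ∃ λ w → SAdj n u w × dist w x ≡ k
  descend-rung {u} {w} {k} x u~w pu≡pw du≡1+dw u-x≡1+k = w , u~w , suc-injective (begin
    suc (dist w x)                                                  ≡⟨ +-suc _ _ ⟨
    ⌈ cdist (pos w) (pos x) /2⌉ + suc (detour (layer w) (layer x))  ≡⟨ cong₂ (λ p t → ⌈ cdist p (pos x) /2⌉ + t)
                                                                              pu≡pw du≡1+dw ⟨
    dist u x                                                        ≡⟨ u-x≡1+k ⟩
    suc k                                                           ∎)
    where open ≡-Reasoning

  cdist≢0-by-detour : ∀ u x {k} → detour (layer u) (layer x) ≡ 0 → dist u x ≡ suc k →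
                      cdist (pos u) (pos x) ≢ 0
  cdist≢0-by-detour u x du≡0 u-x≡1+k H≡0 =
    0≢1+n (trans (sym (cong₂ (λ h t → ⌈ h /2⌉ + t) H≡0 du≡0)) u-x≡1+k)

  cdist≢0-across-sides : ∀ u x → side-parity u x ≡ 1ℙ → cdist (pos u) (pos x) ≢ 0
  cdist≢0-across-sides u x sides-differ H≡0 =
    ℙ.p≢p⁻¹ 0ℙ (trans (cong parity (sym H≡0)) (trans (cdist-pos-parity u x) sides-differ))

  cdist≢1-on-one-side : ∀ u x → side-parity u x ≡ 0ℙ → cdist (pos u) (pos x) ≢ 1
  cdist≢1-on-one-side u x sides-agree H≡1 =
    ℙ.p≢p⁻¹ 1ℙ (trans (cong parity (sym H≡1)) (trans (cdist-pos-parity u x) sides-agree))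

  dist-descent : ∀ u x {k} → dist u x ≡ suc k → ∃ λ w → SAdj n u w × dist w x ≡ k
  dist-descent u@(a , _) x@(a , _) eq =
    descend-horizontally u x eq (cdist≢0-by-detour u x refl eq) (⊥-elim ∘ cdist≢1-on-one-side u x refl)
  dist-descent u@(d , _) x@(d , _) eq =
    descend-horizontally u x eq (cdist≢0-by-detour u x refl eq) (⊥-elim ∘ cdist≢1-on-one-side u x refl)
  dist-descent u@(b , i) x@(b , _) eq =
    descend-horizontally u x eq (cdist≢0-by-detour u x refl eq) (λ _ → band-neighbours-b i)
  dist-descent u@(b , i) x@(c , _) eq =
    descend-horizontally u x eq (cdist≢0-by-detour u x refl eq) (λ _ → band-neighbours-b i)
  dist-descent u@(c , i) x@(b , _) eq =
    descend-horizontally u x eq (cdist≢0-by-detour u x refl eq) (λ _ → band-neighbours-c i)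
  dist-descent u@(c , i) x@(c , _) eq =
    descend-horizontally u x eq (cdist≢0-by-detour u x refl eq) (λ _ → band-neighbours-c i)
  dist-descent u@(b , i) x@(d , _) eq =
    descend-horizontally u x eq (cdist≢0-across-sides u x refl) (λ _ → band-neighbours-b i)
  dist-descent u@(c , i) x@(a , _) eq =
    descend-horizontally u x eq (cdist≢0-across-sides u x refl) (λ _ → band-neighbours-c i)
  dist-descent (a , i) x@(b , _) = descend-rung x (inj₁ (ab i)) refl refl
  dist-descent (a , i) x@(c , _) = descend-rung x (inj₁ (ab i)) refl refl
  dist-descent (a , i) x@(d , _) = descend-rung x (inj₁ (ab i)) refl refl
  dist-descent (b , i) x@(a , _) = descend-rung x (inj₂ (ab i)) refl refl
  dist-descent (c , i) x@(d , _) = descend-rung x (inj₁ (cd i)) refl refl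
  dist-descent (d , i) x@(a , _) = descend-rung x (inj₂ (cd i)) refl refl
  dist-descent (d , i) x@(b , _) = descend-rung x (inj₂ (cd i)) refl refl
  dist-descent (d , i) x@(c , _) = descend-rung x (inj₂ (cd i)) refl refl

  horizontal-lipschitz : ∀ u w x {s} → s ≤ 2 → pos u + s ≋ pos w →
                    detour (layer u) (layer x) ≡ detour (layer w) (layer x) →
                    dist u x ≤ suc (dist w x) × dist w x ≤ suc (dist u x)
  horizontal-lipschitz u w x {s} s≤2 u+s≋w du≡dw =
      +-mono-≤ (halve (proj₁ lipschitz)) (≤-reflexive du≡dw)
    , +-mono-≤ (halve (proj₂ lipschitz)) (≤-reflexive (sym du≡dw))
    where
    lipschitz : cdist (pos u) (pos x) ≤ s + cdist (pos w) (pos x) ×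
                cdist (pos w) (pos x) ≤ s + cdist (pos u) (pos x)
    lipschitz = cdist-lipschitz (pos x) u+s≋w
    halve : ∀ {h h'} → h ≤ s + h' → ⌈ h /2⌉ ≤ suc ⌈ h' /2⌉
    halve {h} {h'} h≤s+h' = ⌈n/2⌉-mono (≤-trans h≤s+h' (+-monoˡ-≤ h' s≤2))

  rung-lipschitz : ∀ u w x → pos u ≡ pos w → ∣ detour (layer u) (layer x) - detour (layer w) (layer x) ∣ ≡ 1 →
                   dist u x ≤ suc (dist w x) × dist w x ≤ suc (dist u x)
  rung-lipschitz u w x pu≡pw apart =
      one-way pu≡pw apart
    , one-way (sym pu≡pw) (trans (∣-∣-comm (detour (layer w) (layer x)) (detour (layer u) (layer x))) apart)
    where
    one-way : ∀ {p p' t t'} → p ≡ p' → ∣ t - t' ∣ ≡ 1 →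
              ⌈ cdist p (pos x) /2⌉ + t ≤ suc (⌈ cdist p' (pos x) /2⌉ + t')
    one-way {p} {p'} {t} {t'} refl t~t' = begin
      ⌈ cdist p (pos x) /2⌉ + t               ≤⟨ +-monoʳ-≤ ⌈ cdist p (pos x) /2⌉ (m≤n+∣m-n∣ t t') ⟩
      ⌈ cdist p (pos x) /2⌉ + (t' + ∣ t - t' ∣) ≡⟨ cong (λ e → ⌈ cdist p (pos x) /2⌉ + (t' + e)) t~t' ⟩
      ⌈ cdist p (pos x) /2⌉ + (t' + 1)        ≡⟨ cong (⌈ cdist p (pos x) /2⌉ +_) (+-comm t' 1) ⟩
      ⌈ cdist p (pos x) /2⌉ + suc t'          ≡⟨ +-suc _ t' ⟩
      suc (⌈ cdist p (pos x) /2⌉ + t')        ∎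
      where open ≤-Reasoning

  dist-lipschitz : ∀ x {u w} → SEdge n u w → dist u x ≤ suc (dist w x) × dist w x ≤ suc (dist u x)
  dist-lipschitz x (aa i)  = horizontal-lipschitz (a , i) (a , next i) x ≤-refl (layer-step a i) refl
  dist-lipschitz x (bb i)  = horizontal-lipschitz (b , i) (b , next i) x ≤-refl (layer-step b i) refl
  dist-lipschitz x (cc i)  = horizontal-lipschitz (c , i) (c , next i) x ≤-refl (layer-step c i) refl
  dist-lipschitz x (dd i)  = horizontal-lipschitz (d , i) (d , next i) x ≤-refl (layer-step d i) refl
  dist-lipschitz x (bc i)  = horizontal-lipschitz (b , i) (c , i) x (n≤1+n 1) (b→c i) (detour-bc (layer x))
  dist-lipschitz x (bc' i) = swap (horizontal-lipschitz (c , i) (b , next i) x (n≤1+n 1) (c→b i) (sym (detour-bc (layer x))))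
  dist-lipschitz x (ab i)  = rung-lipschitz (a , i) (b , i) x refl (rung-ab (layer x))
  dist-lipschitz x (cd i)  = rung-lipschitz (c , i) (d , i) x refl (rung-cd (layer x))

  dist-self : ∀ x → dist x x ≡ 0
  dist-self x = cong₂ (λ h t → ⌈ h /2⌉ + t) (cdist-self (pos x)) (detour-self (layer x))

  dist≡0⇒≡ : ∀ {u x} → dist u x ≡ 0 → u ≡ x
  dist≡0⇒≡ {u} {x} u-x≡0 = same-place
    (≋⇒≡ (pos<N u) (pos<N x) (cdist≡0⇒≋ (⌈n/2⌉≡0⇒n≡0 (m+n≡0⇒m≡0 _ u-x≡0))))
    (m+n≡0⇒n≡0 _ u-x≡0)

  dist-isDistanceTo : ∀ x → IsDistanceTo (SAdj n) x (λ u → dist u x)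
  dist-isDistanceTo x = record
    { φ-target    = dist-self x
    ; φ≡0⇒target  = dist≡0⇒≡
    ; φ-descent   = dist-descent _ x
    ; φ-lipschitz = λ { (inj₁ u→w) → proj₁ (dist-lipschitz x u→w)
                      ; (inj₂ w→u) → proj₂ (dist-lipschitz x w→u)
                      }
    }

  rung-unequalizable : ∀ u v → pos u ≡ pos v → (∀ l → ∣ detour (layer u) l - detour (layer v) l ∣ ≡ 1) →
                       ∀ x → ¬ Equidistant (SAdj n) x u v
  rung-unequalizable u v pu≡pv apart x equidistant = 1≢0 (trans (sym (apart (layer x))) (m≡n⇒∣m-n∣≡0 same-detour))
    where
    1≢0 : 1 ≢ 0
    1≢0 ()
    same-detour : detour (layer u) (layer x) ≡ detour (layer v) (layer x)
    same-detour = +-cancelˡ-≡ ⌈ cdist (pos u) (pos x) /2⌉ _ _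
      (trans (equidistant⇒≡ (SAdj n) dist-isDistanceTo equidistant)
             (cong (λ p → ⌈ cdist p (pos x) /2⌉ + detour (layer v) (layer x)) (sym pu≡pv)))

  _≟ᴸ_ : DecidableEquality Layer
  a ≟ᴸ a = yes refl
  a ≟ᴸ b = no λ ()
  a ≟ᴸ c = no λ ()
  a ≟ᴸ d = no λ ()
  b ≟ᴸ a = no λ ()
  b ≟ᴸ b = yes refl
  b ≟ᴸ c = no λ ()
  b ≟ᴸ d = no λ ()
  c ≟ᴸ a = no λ ()
  c ≟ᴸ b = no λ ()
  c ≟ᴸ c = yes refl
  c ≟ᴸ d = no λ ()
  d ≟ᴸ a = no λ ()
  d ≟ᴸ b = no λ ()
  d ≟ᴸ c = no λ ()
  d ≟ᴸ d = yes refl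

  rung-label : SV n → Fin (n + n)
  rung-label (a , i) = i ↑ˡ n
  rung-label (b , i) = i ↑ˡ n
  rung-label (c , i) = n ↑ʳ i
  rung-label (d , i) = n ↑ʳ i

  equalizer-length-≥ : ∀ S → IsDistanceEqualizer (SAdj n) S → n + n ≤ length S
  equalizer-length-≥ S isDE = onto-Fin⇒≤length S rung-label rung-met
    where
    met : ∀ {u v k} → u ≢ v → (∀ x → ¬ Equidistant (SAdj n) x u v) → rung-label u ≡ k → rung-label v ≡ k →
          ∃ λ w → w ∈ S × rung-label w ≡ k
    met u≢v unequal ℓu ℓv = [ (λ u∈S → _ , u∈S , ℓu) , (λ v∈S → _ , v∈S , ℓv) ]′
      (equalizer-meets-pair (SAdj n) (≡-dec _≟ᴸ_ _≟ᶠ_) isDE u≢v unequal)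
    rung-met : ∀ k → ∃ λ w → w ∈ S × rung-label w ≡ k
    rung-met k with splitAt n k in split≡
    ... | inj₁ i = met (λ ()) (rung-unequalizable (a , i) (b , i) refl rung-ab)
                       (splitAt⁻¹-↑ˡ split≡) (splitAt⁻¹-↑ˡ split≡)
    ... | inj₂ i = met (λ ()) (rung-unequalizable (c , i) (d , i) refl rung-cd)
                       (splitAt⁻¹-↑ʳ split≡) (splitAt⁻¹-↑ʳ split≡)

  data Landmark : Layer → Set where
    a-landmark : Landmark a
    c-landmark : Landmark c

  landmark-detour : ∀ {l} → Landmark l → detour d l ≡ suc (detour b l)
  landmark-detour a-landmark = refl
  landmark-detour c-landmark = refl

  row : Layer → List (SV n)
  row l = map (l ,_) (allFin n)

  S₀ : List (SV n)
  S₀ = row a ++ row c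

  landmark∈S₀ : ∀ {l} → Landmark l → ∀ i → (l , i) ∈ S₀
  landmark∈S₀ a-landmark i = ∈-++⁺ˡ (∈-map⁺ (a ,_) (∈-allFin i))
  landmark∈S₀ c-landmark i = ∈-++⁺ʳ (row a) (∈-map⁺ (c ,_) (∈-allFin i))

  S₀-unique : Unique S₀
  S₀-unique = ++⁺ (row-unique a) (row-unique c) disjoint
    where
    row-unique : ∀ l → Unique (row l)
    row-unique l = map⁺ (cong proj₂) (allFin⁺ n)
    disjoint : ∀ {v} → ¬ (v ∈ row a × v ∈ row c)
    disjoint (v∈a , v∈c) with ∈-map⁻ (a ,_) v∈a | ∈-map⁻ (c ,_) v∈c
    ... | _ , _ , refl | _ , _ , ()

  S₀-length : length S₀ ≡ n + n
  S₀-length = trans (length-++ (row a) {row c}) (cong₂ _+_ (row-length a) (row-length c))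
    where
    row-length : ∀ l → length (row l) ≡ n
    row-length l = trans (length-map (l ,_) (allFin n)) (length-tabulate id)

  half-< : ∀ {k} → k + k < N → k < n
  half-< {k} k+k<N = ≰⇒> (λ n≤k → <⇒≱ k+k<N (+-mono-≤ n≤k n≤k))

  landmark-at : ∀ {X} → X < N → ∃₂ λ l i → Landmark l × pos (l , i) ≡ X
  landmark-at {X} X<N with halving X
  ... | even k = a , fromℕ< k<n , a-landmark , cong (λ t → t + t) (toℕ-fromℕ< k<n)
    where
    k<n : k < n
    k<n = half-< X<N
  ... | odd k  = c , fromℕ< k<n , c-landmark , cong (λ t → suc (t + t)) (toℕ-fromℕ< k<n)
    where
    k<n : k < n
    k<n = half-< (<-trans (n<1+n (k + k)) X<N)

  equalizer-in-S₀ : ∀ {u v} → (∃ λ x → x ∈ S₀ × dist u x ≡ dist v x) →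
                    ∃ λ x → x ∈ S₀ × Equidistant (SAdj n) x u v
  equalizer-in-S₀ (x , x∈S₀ , u-x≡v-x) = x , x∈S₀ , ≡⇒equidistant (SAdj n) dist-isDistanceTo u-x≡v-x

  same-layer-equalized : ∀ l i j → ∃ λ x → x ∈ S₀ × dist (l , i) x ≡ dist (l , j) x
  same-layer-equalized l i j
    with X , X<N , iX≡jX ← even-arc-midpoint (pos (l , i)) (pos (l , j))
                             (trans (cdist-pos-parity (l , i) (l , j)) (ℙ.p+p≡0ℙ (parity (side l))))
    with l' , k , landmark , refl ← landmark-at X<N
    = (l' , k) , landmark∈S₀ landmark k , cong (λ h → ⌈ h /2⌉ + detour l l') iX≡jX

  N≡4q : ∀ q → n ≡ q * 2 → N ≡ q * 4
  N≡4q q n≡2q = trans (cong₂ _+_ n≡2q n≡2q) (double-double q)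
    where
    double-double : ∀ q → q * 2 + q * 2 ≡ q * 4
    double-double = solve-∀

  b-d-equalized : 2 ∣ n → ∀ i j → ∃ λ x → x ∈ S₀ × dist (b , i) x ≡ dist (d , j) x
  b-d-equalized (divides q n≡2q) i j
    with X , w , X<N , iX≡2w+1 , jX≡2w ← odd-arc-split {q} (N≡4q q n≡2q) (pos (b , i)) (pos (d , j))
                                           (cdist-pos-parity (b , i) (d , j))
    with l , k , landmark , refl ← landmark-at X<N
    = (l , k) , landmark∈S₀ landmark k , (begin
      ⌈ cdist (pos (b , i)) (pos (l , k)) /2⌉ + detour b l  ≡⟨ cong (λ h → ⌈ h /2⌉ + detour b l) iX≡2w+1 ⟩
      ⌈ suc (w + w) /2⌉ + detour b l                       ≡⟨ cong (λ h → suc h + detour b l) (n≡⌊n+n/2⌋ w) ⟨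
      suc (w + detour b l)                                 ≡⟨ +-suc w (detour b l) ⟨
      w + suc (detour b l)                                 ≡⟨ cong₂ _+_ (n≡⌈n+n/2⌉ w) (sym (landmark-detour landmark)) ⟩
      ⌈ w + w /2⌉ + detour d l                             ≡⟨ cong (λ h → ⌈ h /2⌉ + detour d l) jX≡2w ⟨
      ⌈ cdist (pos (d , j)) (pos (l , k)) /2⌉ + detour d l  ∎)
    where open ≡-Reasoning

  S₀-isDistanceEqualizer : 2 ∣ n → IsDistanceEqualizer (SAdj n) S₀
  S₀-isDistanceEqualizer _   (a , i) _       _ u∉S₀ _    = ⊥-elim (u∉S₀ (landmark∈S₀ a-landmark i))
  S₀-isDistanceEqualizer _   (c , i) _       _ u∉S₀ _    = ⊥-elim (u∉S₀ (landmark∈S₀ c-landmark i))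
  S₀-isDistanceEqualizer _   (b , _) (a , j) _ _    v∉S₀ = ⊥-elim (v∉S₀ (landmark∈S₀ a-landmark j))
  S₀-isDistanceEqualizer _   (b , _) (c , j) _ _    v∉S₀ = ⊥-elim (v∉S₀ (landmark∈S₀ c-landmark j))
  S₀-isDistanceEqualizer _   (d , _) (a , j) _ _    v∉S₀ = ⊥-elim (v∉S₀ (landmark∈S₀ a-landmark j))
  S₀-isDistanceEqualizer _   (d , _) (c , j) _ _    v∉S₀ = ⊥-elim (v∉S₀ (landmark∈S₀ c-landmark j))
  S₀-isDistanceEqualizer _   (b , i) (b , j) _ _    _    = equalizer-in-S₀ (same-layer-equalized b i j)
  S₀-isDistanceEqualizer _   (d , i) (d , j) _ _    _    = equalizer-in-S₀ (same-layer-equalized d i j)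
  S₀-isDistanceEqualizer 2∣n (b , i) (d , j) _ _    _    = equalizer-in-S₀ (b-d-equalized 2∣n i j)
  S₀-isDistanceEqualizer 2∣n (d , i) (b , j) _ _    _    =
    let x , x∈S₀ , dj-x≡bi-x = b-d-equalized 2∣n j i in equalizer-in-S₀ (x , x∈S₀ , sym dj-x≡bi-x)

mainTheorem5 : (n : ℕ) → 6 ≤ n → 2 ∣ n → EqDimIs (SAdj n) (2 * n)
mainTheorem5 (suc m) _ 2∣n =
    (S₀ , S₀-unique , S₀-isDistanceEqualizer 2∣n , trans S₀-length n+n≡2*n)
  , λ S _ isDE → subst (_≤ length S) n+n≡2*n (equalizer-length-≥ S isDE)
  where
  open S'' m
  n+n≡2*n : n + n ≡ 2 * n
  n+n≡2*n = cong (n +_) (sym (+-identityʳ n))
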